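{- Consider an edge-to-edge tiling of the sphere by congruent quadrilaterals with all vertices of degree $\ge3$. If two angles $\theta_1,\theta_2$ of the tile do not appear at any degree-$3$ vertex, then one of the following holds: - there is a degree-$4$ vertex of the form $\theta_i^3\cdots$ (for some $i\in\{1,2\}$) or of the form $\theta_i^2\theta_j\cdots$ (for some $i,j\in\{1,2\}$); - there is a degree-$5$ vertex of the form $\theta_i^k\theta_j^l$ with $k+l=5$.
   Context: The tile's four angles are treated as four labels. The notation $\theta^k\cdots$ means a vertex containing at least $k$ copies of $\theta$, with the remaining angles unspecified. $\theta_i^k\theta_j^l$ denotes a vertex consisting only of $k$ copies of $\theta_i$ and $l$ copies of $\theta_j$. The degree of a vertex is the number of angles at it. -}

module Defs where

open import Data.Nat using (ℕ; zero; suc; _+_; _*_; _≥_)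
open import Data.Fin using (Fin; zero; suc)
open import Data.Fin.Properties using (_≟_)
open import Data.Product using (Σ; _×_; _,_; proj₁; proj₂)
open import Data.Sum using (_⊎_)
open import Data.List using (List; length; filter; allFin)
open import Relation.Binary.PropositionalEquality using (_≡_; _≢_)

-- The four angle labels θ₀,θ₁,θ₂,θ₃ of the tile, listed in cyclic order
-- around the tile boundary.
Angle : Set
Angle = Fin 4

next : Angle → Angle
next zero = suc zero
next (suc zero) = suc (suc zero)
next (suc (suc zero)) = suc (suc (suc zero))
next (suc (suc (suc zero))) = zero

-- Tiles are Fin nF, vertices Fin nV.  corner t a is the
-- vertex at which the angle with label a of tile t sits.  The side (t , a) of
-- tile t is the edge joining its corners a and next a.  Edge-to-edge: every
-- tile side is glued (by a fixed-point-free involution) to exactly one side of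
-- another tile, with the same two endpoints.  The sphere is encoded by the
-- Euler formula V - E + F = 2 with E the number of edges.
record QuadTiling : Set where
  field
    nV nF nE : ℕ
    corner : Fin nF → Angle → Fin nV
    glue : Fin nF × Angle → Fin nF × Angle
    glue-invol : ∀ s → glue (glue s) ≡ s
    glue-other-tile : ∀ s → proj₁ (glue s) ≢ proj₁ s
    glue-endpoints : ∀ t a →
      let s = proj₁ (glue (t , a)) ; b = proj₂ (glue (t , a)) in
      (corner t a ≡ corner s b × corner t (next a) ≡ corner s (next b))
      ⊎ (corner t a ≡ corner s (next b) × corner t (next a) ≡ corner s b)
    edge-count : 2 * nE ≡ 4 * nF
    euler : nV + nF ≡ 2 + nE

  count : Fin nV → Angle → ℕ
  count v a = length (filter (λ t → corner t a ≟ v) (allFin nF))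

  degree : Fin nV → ℕ
  degree v = count v zero + count v (suc zero) + count v (suc (suc zero))
             + count v (suc (suc (suc zero)))

-- Summing the angle counts over all vertices gives Σ_v degree v = 4F and
-- Σ_v (#θ₁ + #θ₂) = 2F, while Euler's formula with E = 2F gives V = F + 2.
-- If no vertex of the listed kinds exists, every vertex satisfies
-- 6 + #θ₁ + #θ₂ ≤ 2 · degree (degree 3 carries no θ₁, θ₂; a degree-4 vertex
-- carries at most two of them; a degree-5 vertex at most four).  Summing,
-- 6V + 2F ≤ 8F, i.e. V ≤ F, contradicting V = F + 2.
module Submission where

open import Defs
open import Data.Nat.Properties renaming (_≟_ to _≟ℕ_)
open import Algebra.Properties.Semiring.Sum +-*-semiring
  using (sum; sum-syntax; sum-cong-≗; ∑-distrib-+; ∑-comm; *-distribˡ-sum)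
open import Data.Bool using (if_then_else_)
open import Data.Fin using (Fin; zero; suc)
open import Data.Fin.Patterns using (0F; 1F; 2F; 3F)
open import Data.Fin.Properties using (_≟_; all?; ¬∀⟶∃¬)
open import Data.List using ([]; _∷_; length; filter; allFin)
open import Data.List.Properties using (length-tabulate)
open import Data.Nat using (ℕ; zero; suc; _+_; _*_; _≤_; _≥_; _≤?_; z≤n; s≤s)
open import Data.Nat.Tactic.RingSolver using (solve-∀)
open import Data.Product using (Σ; ∃; _×_; _,_; uncurry)
open import Data.Sum using (_⊎_; inj₁; inj₂)
open import Function using (_∘_)
open import Relation.Nullary using (¬_; does; yes; no; contradiction)
open import Relation.Binary.PropositionalEquality
  using (_≡_; _≢_; refl; sym; trans; cong; cong₂; module ≡-Reasoning)

∑-const : ∀ n c → ∑[ i < n ] c ≡ n * c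
∑-const zero    c = refl
∑-const (suc n) c = cong (c +_) (∑-const n c)

∑-mono-≤ : ∀ {n} {f g : Fin n → ℕ} → (∀ i → f i ≤ g i) → sum f ≤ sum g
∑-mono-≤ {zero}  f≤g = z≤n
∑-mono-≤ {suc n} f≤g = +-mono-≤ (f≤g zero) (∑-mono-≤ (f≤g ∘ suc))

∑-single-≤ : ∀ {n} (f : Fin n → ℕ) i → f i ≤ sum f
∑-single-≤ f zero    = m≤m+n _ _
∑-single-≤ f (suc i) = ≤-trans (∑-single-≤ (f ∘ suc) i) (m≤n+m _ _)

∑-pair-≤ : ∀ {n} (f : Fin n → ℕ) {i j} → i ≢ j → f i + f j ≤ sum f
∑-pair-≤ f {zero}  {zero}  i≢j = contradiction refl i≢j
∑-pair-≤ f {zero}  {suc j} _   = +-monoʳ-≤ (f zero) (∑-single-≤ (f ∘ suc) j)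
∑-pair-≤ f {suc i} {zero}  _   =
  ≤-trans (≤-reflexive (+-comm (f (suc i)) (f zero)))
          (+-monoʳ-≤ (f zero) (∑-single-≤ (f ∘ suc) i))
∑-pair-≤ f {suc i} {suc j} i≢j =
  ≤-trans (∑-pair-≤ (f ∘ suc) (i≢j ∘ cong suc)) (m≤n+m _ _)

δ : ∀ {n} → Fin n → Fin n → ℕ
δ c v = if does (c ≟ v) then 1 else 0

∑-δ : ∀ {n} (c : Fin n) → ∑[ v < n ] δ c v ≡ 1
∑-δ {suc n} zero    = cong suc (trans (∑-const n 0) (*-zeroʳ n))
∑-δ {suc n} (suc c) = ∑-δ c

module _ {A : Set} {n : ℕ} (g : A → Fin n) where

  length-filter-∷ : ∀ x xs v →
    length (filter (λ y → g y ≟ v) (x ∷ xs)) ≡ δ (g x) v + length (filter (λ y → g y ≟ v) xs)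
  length-filter-∷ x xs v with g x ≟ v
  ... | yes _ = refl
  ... | no  _ = refl

  ∑-fibre-length : ∀ xs → ∑[ v < n ] length (filter (λ x → g x ≟ v) xs) ≡ length xs
  ∑-fibre-length []       = trans (∑-const n 0) (*-zeroʳ n)
  ∑-fibre-length (x ∷ xs) = begin
    ∑[ v < n ] length (filter (λ y → g y ≟ v) (x ∷ xs))
      ≡⟨ sum-cong-≗ (length-filter-∷ x xs) ⟩
    ∑[ v < n ] (δ (g x) v + length (filter (λ y → g y ≟ v) xs))
      ≡⟨ ∑-distrib-+ (δ (g x)) _ ⟩
    ∑[ v < n ] δ (g x) v + ∑[ v < n ] length (filter (λ y → g y ≟ v) xs)
      ≡⟨ cong₂ _+_ (∑-δ (g x)) (∑-fibre-length xs) ⟩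
    suc (length xs)
      ∎
    where open ≡-Reasoning

m+n≥3-cases : ∀ {m n} → m + n ≥ 3 → (m ≥ 3 ⊎ n ≥ 3) ⊎ (m ≥ 2 × n ≥ 1 ⊎ n ≥ 2 × m ≥ 1)
m+n≥3-cases {0}                 n≥3              = inj₁ (inj₂ n≥3)
m+n≥3-cases {1}                 (s≤s n≥2)        = inj₂ (inj₂ (n≥2 , s≤s z≤n))
m+n≥3-cases {2}                 (s≤s (s≤s n≥1))  = inj₂ (inj₁ (s≤s (s≤s z≤n) , n≥1))
m+n≥3-cases {suc (suc (suc m))} _                = inj₁ (inj₁ (s≤s (s≤s (s≤s z≤n))))

degree-dichotomy : ∀ {s} d → s ≤ d → d ≥ 3 → (d ≡ 3 → s ≡ 0) →
  (d ≡ 4 × s ≥ 3) ⊎ (d ≡ 5 × s ≡ 5) ⊎ 6 + s ≤ 2 * d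
degree-dichotomy 1 _ (s≤s ())       _
degree-dichotomy 2 _ (s≤s (s≤s ())) _
degree-dichotomy 3 _ _ s≡0 = inj₂ (inj₂ (≤-reflexive (cong (6 +_) (s≡0 refl))))
degree-dichotomy {s} 4 _ _ _ with s ≤? 2
... | yes s≤2 = inj₂ (inj₂ (+-monoʳ-≤ 6 s≤2))
... | no  s≰2 = inj₁ (refl , ≰⇒> s≰2)
degree-dichotomy {s} 5 s≤5 _ _ with s ≟ℕ 5
... | yes s≡5 = inj₂ (inj₁ (refl , s≡5))
... | no  s≢5 = inj₂ (inj₂ (+-monoʳ-≤ 6 (m<1+n⇒m≤n (≤∧≢⇒< s≤5 s≢5))))
degree-dichotomy d@(suc (suc (suc (suc (suc (suc k)))))) s≤d _ _ =
  inj₂ (inj₂ (+-mono-≤ (m≤m+n 6 k) (≤-trans s≤d (m≤m+n d 0))))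

module _ (T : QuadTiling) where
  open QuadTiling T

  degree≡∑count : ∀ v → degree v ≡ ∑[ a < 4 ] count v a
  degree≡∑count v = reassoc (count v 0F) (count v 1F) (count v 2F) (count v 3F)
    where
    reassoc : ∀ a b c d → a + b + c + d ≡ a + (b + (c + (d + 0)))
    reassoc = solve-∀

  count-pair-≤-degree : ∀ v {θ θ′} → θ ≢ θ′ → count v θ + count v θ′ ≤ degree v
  count-pair-≤-degree v θ≢θ′ =
    ≤-trans (∑-pair-≤ (count v) θ≢θ′) (≤-reflexive (sym (degree≡∑count v)))

  ∑-count : ∀ a → ∑[ v < nV ] count v a ≡ nF
  ∑-count a = trans (∑-fibre-length (λ t → corner t a) (allFin nF)) (length-tabulate _)

  ∑-degree : ∑[ v < nV ] degree v ≡ 4 * nF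
  ∑-degree = begin
    ∑[ v < nV ] degree v                 ≡⟨ sum-cong-≗ degree≡∑count ⟩
    ∑[ v < nV ] ∑[ a < 4 ] count v a     ≡⟨ ∑-comm (λ v a → count v a) ⟩
    ∑[ a < 4 ] ∑[ v < nV ] count v a     ≡⟨ sum-cong-≗ ∑-count ⟩
    ∑[ a < 4 ] nF                        ≡⟨ ∑-const 4 nF ⟩
    4 * nF                               ∎
    where open ≡-Reasoning

  nV≡2+nF : nV ≡ 2 + nF
  nV≡2+nF = +-cancelʳ-≡ nF nV (2 + nF) (begin
    nV + nF       ≡⟨ euler ⟩
    2 + nE        ≡⟨ cong (2 +_) nE≡2*nF ⟩
    2 + 2 * nF    ≡⟨ cong (λ x → 2 + (nF + x)) (+-identityʳ nF) ⟩
    2 + nF + nF   ∎)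
    where
    open ≡-Reasoning
    nE≡2*nF : nE ≡ 2 * nF
    nE≡2*nF = *-cancelˡ-≡ nE (2 * nF) 2 (trans edge-count (*-assoc 2 2 nF))

  ∑-6+count-pair : ∀ θ₁ θ₂ → ∑[ v < nV ] (6 + (count v θ₁ + count v θ₂)) ≡ nV * 6 + (nF + nF)
  ∑-6+count-pair θ₁ θ₂ = begin
    ∑[ v < nV ] (6 + (count v θ₁ + count v θ₂))
      ≡⟨ ∑-distrib-+ (λ _ → 6) (λ v → count v θ₁ + count v θ₂) ⟩
    ∑[ v < nV ] 6 + ∑[ v < nV ] (count v θ₁ + count v θ₂)
      ≡⟨ cong (∑[ v < nV ] 6 +_) (∑-distrib-+ (λ v → count v θ₁) (λ v → count v θ₂)) ⟩
    ∑[ v < nV ] 6 + (∑[ v < nV ] count v θ₁ + ∑[ v < nV ] count v θ₂)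
      ≡⟨ cong₂ _+_ (∑-const nV 6) (cong₂ _+_ (∑-count θ₁) (∑-count θ₂)) ⟩
    nV * 6 + (nF + nF)
      ∎
    where open ≡-Reasoning

  Light : Angle → Angle → Fin nV → Set
  Light θ₁ θ₂ v = 6 + (count v θ₁ + count v θ₂) ≤ 2 * degree v

  ¬-all-light : ∀ θ₁ θ₂ → ¬ (∀ v → Light θ₁ θ₂ v)
  ¬-all-light θ₁ θ₂ light = contradiction (+-cancelʳ-≤ (2 * (4 * nF)) 12 0 12+8F≤8F) λ ()
    where
    open ≤-Reasoning
    arith : ∀ F → 12 + 2 * (4 * F) ≡ (2 + F) * 6 + (F + F)
    arith = solve-∀
    12+8F≤8F : 12 + 2 * (4 * nF) ≤ 2 * (4 * nF)
    12+8F≤8F = begin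
      12 + 2 * (4 * nF)                            ≡⟨ arith nF ⟩
      (2 + nF) * 6 + (nF + nF)                     ≡⟨ cong (λ V → V * 6 + (nF + nF)) nV≡2+nF ⟨
      nV * 6 + (nF + nF)                           ≡⟨ ∑-6+count-pair θ₁ θ₂ ⟨
      ∑[ v < nV ] (6 + (count v θ₁ + count v θ₂))  ≤⟨ ∑-mono-≤ light ⟩
      ∑[ v < nV ] (2 * degree v)                   ≡⟨ *-distribˡ-sum 2 degree ⟨
      2 * ∑[ v < nV ] degree v                     ≡⟨ cong (2 *_) ∑-degree ⟩
      2 * (4 * nF)                                 ∎

  ∃-heavy-vertex : ∀ θ₁ θ₂ → ∃ λ v → ¬ Light θ₁ θ₂ v
  ∃-heavy-vertex θ₁ θ₂ with all? (λ v → 6 + (count v θ₁ + count v θ₂) ≤? 2 * degree v)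
  ... | yes light  = contradiction light (¬-all-light θ₁ θ₂)
  ... | no  ¬light = ¬∀⟶∃¬ nV _ (λ v → _ ≤? _) ¬light

lemma4 : (T : QuadTiling) → let open QuadTiling T in
    (∀ v → degree v ≥ 3) →
    (θ₁ θ₂ : Angle) → θ₁ ≢ θ₂ →
    (∀ v → degree v ≡ 3 → count v θ₁ ≡ 0 × count v θ₂ ≡ 0) →
    (Σ (Fin nV) λ v → degree v ≡ 4 ×
        ( ((count v θ₁ ≥ 3) ⊎ (count v θ₂ ≥ 3))
        ⊎ ((count v θ₁ ≥ 2 × count v θ₂ ≥ 1) ⊎ (count v θ₂ ≥ 2 × count v θ₁ ≥ 1))))
    ⊎ (Σ (Fin nV) λ v → degree v ≡ 5 × count v θ₁ + count v θ₂ ≡ 5)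
lemma4 T degree≥3 θ₁ θ₂ θ₁≢θ₂ θs-absent-at-3 with ∃-heavy-vertex T θ₁ θ₂
... | v , heavy
    with degree-dichotomy _ (count-pair-≤-degree T v θ₁≢θ₂)
           (degree≥3 v) (uncurry (cong₂ _+_) ∘ θs-absent-at-3 v)
...   | inj₁ (d≡4 , s≥3)  = inj₁ (v , d≡4 , m+n≥3-cases s≥3)
...   | inj₂ (inj₁ five)  = inj₂ (v , five)
...   | inj₂ (inj₂ light) = contradiction light heavy
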